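{- If $A\in2^\omega$ computes a weakly 1-generic set, then $A$ is an evasion degree.
   Context: A predictor is a pair $P=(D,\langle \pi_n : n\in D\rangle)$ where $D\subseteq\omega$ is infinite and each $\pi_n:\omega^n\to\omega$. $P$ predicts $x\in\omega^\omega$ if for all but finitely many $n\in D$, $\pi_n(x\upharpoonright n)=x(n)$; otherwise $x$ evades $P$. A computable predictor is one where $D$ is computable and $(n,\sigma)\mapsto\pi_n(\sigma)$ is computable. $A$ is an evasion degree if there is $f\le_T A$, $f\in\omega^\omega$, which evades every computable predictor. A set $G\in2^\omega$ is weakly 1-generic if it meets every dense c.e. set of binary strings. -}

module Defs where

open import Data.Nat using (ℕ; zero; suc; _+_; _≤_; _<_)
open import Data.Bool using (Bool; true; false)
open import Data.Fin using (Fin; toℕ)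
open import Data.Vec using (Vec; []; _∷_; lookup; tabulate)
open import Data.List using (List; []; _∷_; map)
open import Data.Product using (Σ; ∃; _×_; _,_)
open import Relation.Binary.PropositionalEquality using (_≡_)
open import Relation.Nullary using (¬_)

tri : ℕ → ℕ
tri zero    = zero
tri (suc k) = suc k + tri k

-- Cantor pairing  ⟨x , y⟩ = (x+y)(x+y+1)/2 + y
pair : ℕ → ℕ → ℕ
pair x y = tri (x + y) + y

codeList : List ℕ → ℕ
codeList []       = zero
codeList (x ∷ xs) = suc (pair x (codeList xs))

codeVec : ∀ {n} → Vec ℕ n → ℕ
codeVec []       = zero
codeVec (x ∷ xs) = suc (pair x (codeVec xs))

χ : Bool → ℕ
χ false = 0
χ true  = 1

codeBin : List Bool → ℕ
codeBin σ = codeList (map χ σ)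

-- Partial recursive functions with an oracle (Kleene's μ-recursive
-- functions extended by an oracle-query instruction)

data PR : ℕ → Set where
  zer    : ∀ {n} → PR n
  succ   : PR 1
  proj   : ∀ {n} → Fin n → PR n
  oracle : PR 1
  comp   : ∀ {m n} → PR m → Vec (PR n) m → PR n
  prim   : ∀ {n} → PR n → PR (suc (suc n)) → PR (suc n)
  mu     : ∀ {n} → PR (suc n) → PR n

-- Big-step semantics relative to an oracle O : ℕ → ℕ.
-- Eval O e xs y  means: program e on input xs with oracle O halts with output y.
mutual
  data Eval (O : ℕ → ℕ) : ∀ {n} → PR n → Vec ℕ n → ℕ → Set where
    e-zer    : ∀ {n} {xs : Vec ℕ n} → Eval O zer xs 0
    e-succ   : ∀ {x} → Eval O succ (x ∷ []) (suc x)
    e-proj   : ∀ {n} {i : Fin n} {xs : Vec ℕ n} → Eval O (proj i) xs (lookup xs i)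
    e-oracle : ∀ {x} → Eval O oracle (x ∷ []) (O x)
    e-comp   : ∀ {m n} {f : PR m} {gs : Vec (PR n) m} {xs : Vec ℕ n}
                 {ys : Vec ℕ m} {y : ℕ} →
               EvalAll O gs xs ys → Eval O f ys y → Eval O (comp f gs) xs y
    e-prim0  : ∀ {n} {g : PR n} {h : PR (suc (suc n))} {xs : Vec ℕ n} {y} →
               Eval O g xs y → Eval O (prim g h) (0 ∷ xs) y
    e-primS  : ∀ {n} {g : PR n} {h : PR (suc (suc n))} {xs : Vec ℕ n} {k r y} →
               Eval O (prim g h) (k ∷ xs) r → Eval O h (k ∷ r ∷ xs) y →
               Eval O (prim g h) (suc k ∷ xs) y
    e-mu     : ∀ {n} {f : PR (suc n)} {xs : Vec ℕ n} {y} →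
               Eval O f (y ∷ xs) 0 →
               (∀ z → z < y → Σ ℕ (λ k → Eval O f (z ∷ xs) (suc k))) →
               Eval O (mu f) xs y

  data EvalAll (O : ℕ → ℕ) {n : ℕ} : ∀ {m} → Vec (PR n) m → Vec ℕ n → Vec ℕ m → Set where
    ea-[] : ∀ {xs} → EvalAll O [] xs []
    ea-∷  : ∀ {m} {g : PR n} {gs : Vec (PR n) m} {xs : Vec ℕ n} {y} {ys : Vec ℕ m} →
            Eval O g xs y → EvalAll O gs xs ys → EvalAll O (g ∷ gs) xs (y ∷ ys)

-- the empty oracle (unrelativized computation)
noOracle : ℕ → ℕ
noOracle _ = 0

_≤T_ : (ℕ → ℕ) → (ℕ → Bool) → Set
f ≤T A = Σ (PR 1) λ e → ∀ n → Eval (λ k → χ (A k)) e (n ∷ []) (f n)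

_≤TSet_ : (ℕ → Bool) → (ℕ → Bool) → Set
G ≤TSet A = (λ n → χ (G n)) ≤T A

restrictBin : (ℕ → Bool) → ℕ → List Bool
restrictBin G zero    = []
restrictBin G (suc n) = restrictBin G n Data.List.++ (G n ∷ [])

restrict : (ℕ → ℕ) → (n : ℕ) → Vec ℕ n
restrict x n = tabulate (λ i → x (toℕ i))

_⪯_ : List Bool → List Bool → Set
σ ⪯ τ = Σ (List Bool) λ ρ → τ ≡ σ Data.List.++ ρ

-- the c.e. set of binary strings with index e (domain of program e)
W : PR 1 → List Bool → Set
W e σ = Σ ℕ λ v → Eval noOracle e (codeBin σ ∷ []) v

Dense : (List Bool → Set) → Set
Dense S = ∀ σ → Σ (List Bool) λ τ → (σ ⪯ τ) × S τ

Meets : (ℕ → Bool) → (List Bool → Set) → Set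
Meets G S = Σ ℕ λ n → S (restrictBin G n)

Weakly1Generic : (ℕ → Bool) → Set
Weakly1Generic G = ∀ (e : PR 1) → Dense (W e) → Meets G (W e)

record Predictor : Set where
  field
    D        : ℕ → Bool
    infinite : ∀ m → Σ ℕ λ n → (m ≤ n) × (D n ≡ true)
    π        : (n : ℕ) → Vec ℕ n → ℕ

open Predictor public

Predicts : Predictor → (ℕ → ℕ) → Set
Predicts P x = Σ ℕ λ m → ∀ n → m ≤ n → D P n ≡ true → π P n (restrict x n) ≡ x n

Evades : (ℕ → ℕ) → Predictor → Set
Evades x P = ¬ Predicts P x

ComputablePredictor : Predictor → Set
ComputablePredictor P =
  (Σ (PR 1) λ eD → ∀ n → Eval noOracle eD (n ∷ []) (χ (D P n))) ×
  (Σ (PR 2) λ eπ → ∀ n (σ : Vec ℕ n) → Eval noOracle eπ (n ∷ codeVec σ ∷ []) (π P n σ))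

EvasionDegree : (ℕ → Bool) → Set
EvasionDegree A = Σ (ℕ → ℕ) λ f → (f ≤T A) × (∀ (P : Predictor) → ComputablePredictor P → Evades f P)

-- Let G ≤T A be weakly 1-generic and let f = χ_G.  Fix a computable
-- predictor P and a threshold m.  The set of binary strings σ that
-- exhibit a misprediction of P beyond m, i.e. for which some n with
-- m ≤ n < |σ| and n ∈ D has π_n(σ↾n) ≠ σ(n), is c.e. and dense: pad σ
-- with zeros up to an element n ≥ m of D and append a bit different
-- from the prediction π_n.  Hence G meets it, so P errs on f beyond m;
-- as m was arbitrary, f evades P.
module Submission where

open import Defs
open import Data.Nat using (ℕ; zero; suc; _+_; _∸_; _≤_; _<_; pred; _⊔_; z≤n; s≤s; s≤s⁻¹)
open import Data.Nat.Properties
open import Data.Bool using (Bool; true; false)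
open import Data.Fin using (#_)
open import Data.Vec using (Vec; []; _∷_)
open import Data.List using (List; []; _∷_; _++_; drop; length; map; replicate)
open import Data.List.Properties using (++-assoc; length-++; map-++; length-map; length-replicate; drop-all)
open import Data.Product using (Σ; _×_; _,_; proj₁; proj₂)
open import Data.Empty using (⊥-elim)
open import Function using (_∘_)
open import Relation.Binary.PropositionalEquality
open import Relation.Binary.Definitions using (tri<; tri≈; tri>)
open import Relation.Nullary using (¬_; yes; no)

-- Evaluation of oracle programs is deterministic.  This lets us read off
-- the value of a subcomputation from any halting derivation.
mutual
  eval-deterministic : ∀ {O n} {e : PR n} {xs y y′} → Eval O e xs y → Eval O e xs y′ → y ≡ y′
  eval-deterministic e-zer    e-zer    = refl
  eval-deterministic e-succ   e-succ   = refl
  eval-deterministic e-proj   e-proj   = refl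
  eval-deterministic e-oracle e-oracle = refl
  eval-deterministic (e-comp as f) (e-comp as′ f′) with evalAll-deterministic as as′
  ... | refl = eval-deterministic f f′
  eval-deterministic (e-prim0 g) (e-prim0 g′) = eval-deterministic g g′
  eval-deterministic (e-primS r h) (e-primS r′ h′) with eval-deterministic r r′
  ... | refl = eval-deterministic h h′
  eval-deterministic (e-mu {y = y} z below) (e-mu {y = y′} z′ below′) with <-cmp y y′
  ... | tri< y<y′ _ _ = ⊥-elim (0≢1+n (eval-deterministic z (proj₂ (below′ y y<y′))))
  ... | tri≈ _ y≡y′ _ = y≡y′
  ... | tri> _ _ y′<y = ⊥-elim (0≢1+n (eval-deterministic z′ (proj₂ (below y′ y′<y))))

  evalAll-deterministic : ∀ {O n m} {gs : Vec (PR n) m} {xs ys ys′} →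
                          EvalAll O gs xs ys → EvalAll O gs xs ys′ → ys ≡ ys′
  evalAll-deterministic ea-[] ea-[] = refl
  evalAll-deterministic (ea-∷ a as) (ea-∷ a′ as′) =
    cong₂ _∷_ (eval-deterministic a a′) (evalAll-deterministic as as′)

mu-halts : ∀ {O n} (f : PR (suc n)) (F : ℕ → ℕ) (xs : Vec ℕ n) →
           (∀ y → Eval O f (y ∷ xs) (F y)) → ∀ y → F y ≡ 0 → Σ ℕ λ v → Eval O (mu f) xs v
mu-halts {O} f F xs total y Fy≡0 = search y 0 refl (λ _ ())
  where
  -- search from b with d candidates left before the known zero y, all
  -- values below b being already known to be nonzero
  search : ∀ d b → b + d ≡ y → (∀ z → z < b → Σ ℕ λ k → Eval O f (z ∷ xs) (suc k)) →
           Σ ℕ λ v → Eval O (mu f) xs v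
  search d b b+d≡y below with F b in Fb
  ... | zero = b , e-mu (subst (Eval O f (b ∷ xs)) Fb (total b)) below
  search zero b b+0≡y below | suc k =
    ⊥-elim (0≢1+n (trans (sym Fy≡0) (trans (cong F (trans (sym b+0≡y) (+-identityʳ b))) Fb)))
  search (suc d) b b+d≡y below | suc k = search d (suc b) (trans (sym (+-suc b d)) b+d≡y) below′
    where
    below′ : ∀ z → z < suc b → Σ ℕ λ k → Eval O f (z ∷ xs) (suc k)
    below′ z z<1+b with <-cmp z b
    ... | tri< z<b _ _ = below z z<b
    ... | tri≈ _ refl _ = k , subst (Eval O f (z ∷ xs)) Fb (total z)
    ... | tri> _ _ b<z = ⊥-elim (<-irrefl refl (<-≤-trans b<z (s≤s⁻¹ z<1+b)))

-- the index of the diagonal of the Cantor pairing containing c, i.e.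
-- the s with tri s ≤ c < tri (suc s); it grows exactly when c reaches
-- the next triangular number
triRoot : ℕ → ℕ
triRoot zero    = zero
triRoot (suc c) = triRoot c + (1 ∸ (tri (suc (triRoot c)) ∸ suc c))

unpair₂ : ℕ → ℕ
unpair₂ c = c ∸ tri (triRoot c)

unpair₁ : ℕ → ℕ
unpair₁ c = triRoot c ∸ unpair₂ c

-- head and tail of a coded list codeList (x ∷ xs) = suc (pair x (codeList xs))
head tail : ℕ → ℕ
head c = unpair₁ (pred c)
tail c = unpair₂ (pred c)

tails : ℕ → ℕ → ℕ
tails zero    c = c
tails (suc k) c = tail (tails k c)

nth : ℕ → ℕ → ℕ
nth j c = head (tails j c)

-- segment k n c is the vector of entries n ∸ k, …, n ∸ 1 of the list
-- coded by c; segment n n c recovers the first n entries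
segment : (k : ℕ) → ℕ → ℕ → Vec ℕ k
segment zero    n c = []
segment (suc k) n c = nth (n ∸ suc k) c ∷ segment k n c

dist : ℕ → ℕ → ℕ
dist a b = (a ∸ b) + (b ∸ a)

-- 0/1-valued zero test: isZero t ≡ 0 exactly when t ≢ 0
isZero : ℕ → ℕ
isZero t = 1 ∸ t

private
  variable
    O : ℕ → ℕ

eval-comp₁ : ∀ {n} {f : PR 1} {g : PR n} {xs a y} →
             Eval O f (a ∷ []) y → Eval O g xs a → Eval O (comp f (g ∷ [])) xs y
eval-comp₁ f g = e-comp (ea-∷ g ea-[]) f

eval-comp₂ : ∀ {n} {f : PR 2} {g h : PR n} {xs a b y} →
             Eval O f (a ∷ b ∷ []) y → Eval O g xs a → Eval O h xs b →
             Eval O (comp f (g ∷ h ∷ [])) xs y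
eval-comp₂ f g h = e-comp (ea-∷ g (ea-∷ h ea-[])) f

eval-comp₃ : ∀ {n} {f : PR 3} {g h k : PR n} {xs a b c y} →
             Eval O f (a ∷ b ∷ c ∷ []) y → Eval O g xs a → Eval O h xs b → Eval O k xs c →
             Eval O (comp f (g ∷ h ∷ k ∷ [])) xs y
eval-comp₃ f g h k = e-comp (ea-∷ g (ea-∷ h (ea-∷ k ea-[]))) f

CONST : ∀ {n} → ℕ → PR n
CONST zero    = zer
CONST (suc m) = comp succ (CONST m ∷ [])

CONST-correct : ∀ {n} m (xs : Vec ℕ n) → Eval O (CONST m) xs m
CONST-correct zero    xs = e-zer
CONST-correct (suc m) xs = eval-comp₁ e-succ (CONST-correct m xs)

PRED : PR 1
PRED = prim zer (proj (# 0))

PRED-correct : ∀ x → Eval O PRED (x ∷ []) (pred x)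
PRED-correct zero    = e-prim0 e-zer
PRED-correct (suc k) = e-primS (PRED-correct k) e-proj

ADD : PR 2
ADD = prim (proj (# 0)) (comp succ (proj (# 1) ∷ []))

ADD-correct : ∀ x y → Eval O ADD (x ∷ y ∷ []) (x + y)
ADD-correct zero    y = e-prim0 e-proj
ADD-correct (suc k) y = e-primS (ADD-correct k y) (eval-comp₁ e-succ e-proj)

-- truncated subtraction with the subtrahend as recursion argument
SUB-FROM : PR 2
SUB-FROM = prim (proj (# 0)) (comp PRED (proj (# 1) ∷ []))

SUB-FROM-correct : ∀ y x → Eval O SUB-FROM (y ∷ x ∷ []) (x ∸ y)
SUB-FROM-correct zero    x = e-prim0 e-proj
SUB-FROM-correct (suc k) x = subst (Eval _ SUB-FROM (suc k ∷ x ∷ [])) (pred[m∸n]≡m∸[1+n] x k)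
  (e-primS (SUB-FROM-correct k x) (eval-comp₁ (PRED-correct (x ∸ k)) e-proj))

MONUS : PR 2
MONUS = comp SUB-FROM (proj (# 1) ∷ proj (# 0) ∷ [])

MONUS-correct : ∀ x y → Eval O MONUS (x ∷ y ∷ []) (x ∸ y)
MONUS-correct x y = eval-comp₂ (SUB-FROM-correct y x) e-proj e-proj

TRI : PR 1
TRI = prim zer (comp ADD (comp succ (proj (# 0) ∷ []) ∷ proj (# 1) ∷ []))

TRI-correct : ∀ k → Eval O TRI (k ∷ []) (tri k)
TRI-correct zero    = e-prim0 e-zer
TRI-correct (suc k) =
  e-primS (TRI-correct k) (eval-comp₂ (ADD-correct (suc k) (tri k)) (eval-comp₁ e-succ e-proj) e-proj)

PAIR : PR 2
PAIR = comp ADD (comp TRI (ADD ∷ []) ∷ proj (# 1) ∷ [])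

PAIR-correct : ∀ x y → Eval O PAIR (x ∷ y ∷ []) (pair x y)
PAIR-correct x y =
  eval-comp₂ (ADD-correct (tri (x + y)) y) (eval-comp₁ (TRI-correct (x + y)) (ADD-correct x y)) e-proj

TRI-ROOT : PR 1
TRI-ROOT = prim zer (comp ADD (proj (# 1) ∷
  comp MONUS (CONST 1 ∷ comp MONUS (comp TRI (comp succ (proj (# 1) ∷ []) ∷ []) ∷
                                    comp succ (proj (# 0) ∷ []) ∷ []) ∷ []) ∷ []))

TRI-ROOT-correct : ∀ c → Eval O TRI-ROOT (c ∷ []) (triRoot c)
TRI-ROOT-correct zero    = e-prim0 e-zer
TRI-ROOT-correct (suc c) = e-primS (TRI-ROOT-correct c)
  (eval-comp₂ (ADD-correct _ _) e-proj (eval-comp₂ (MONUS-correct _ _) (CONST-correct 1 _)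
    (eval-comp₂ (MONUS-correct _ _) (eval-comp₁ (TRI-correct _) (eval-comp₁ e-succ e-proj))
                                    (eval-comp₁ e-succ e-proj))))

UNPAIR₂ : PR 1
UNPAIR₂ = comp MONUS (proj (# 0) ∷ comp TRI (TRI-ROOT ∷ []) ∷ [])

UNPAIR₂-correct : ∀ c → Eval O UNPAIR₂ (c ∷ []) (unpair₂ c)
UNPAIR₂-correct c = eval-comp₂ (MONUS-correct _ _) e-proj (eval-comp₁ (TRI-correct _) (TRI-ROOT-correct c))

UNPAIR₁ : PR 1
UNPAIR₁ = comp MONUS (TRI-ROOT ∷ UNPAIR₂ ∷ [])

UNPAIR₁-correct : ∀ c → Eval O UNPAIR₁ (c ∷ []) (unpair₁ c)
UNPAIR₁-correct c = eval-comp₂ (MONUS-correct _ _) (TRI-ROOT-correct c) (UNPAIR₂-correct c)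

HEAD TAIL : PR 1
HEAD = comp UNPAIR₁ (PRED ∷ [])
TAIL = comp UNPAIR₂ (PRED ∷ [])

HEAD-correct : ∀ c → Eval O HEAD (c ∷ []) (head c)
HEAD-correct c = eval-comp₁ (UNPAIR₁-correct _) (PRED-correct c)

TAIL-correct : ∀ c → Eval O TAIL (c ∷ []) (tail c)
TAIL-correct c = eval-comp₁ (UNPAIR₂-correct _) (PRED-correct c)

TAILS : PR 2
TAILS = prim (proj (# 0)) (comp TAIL (proj (# 1) ∷ []))

TAILS-correct : ∀ k c → Eval O TAILS (k ∷ c ∷ []) (tails k c)
TAILS-correct zero    c = e-prim0 e-proj
TAILS-correct (suc k) c = e-primS (TAILS-correct k c) (eval-comp₁ (TAIL-correct _) e-proj)

NTH : PR 2
NTH = comp HEAD (TAILS ∷ [])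

NTH-correct : ∀ j c → Eval O NTH (j ∷ c ∷ []) (nth j c)
NTH-correct j c = eval-comp₁ (HEAD-correct _) (TAILS-correct j c)

SEGMENT : PR 3
SEGMENT = prim zer (comp succ (comp PAIR
  (comp NTH (comp MONUS (proj (# 2) ∷ comp succ (proj (# 0) ∷ []) ∷ []) ∷ proj (# 3) ∷ []) ∷
   proj (# 1) ∷ []) ∷ []))

SEGMENT-correct : ∀ k n c → Eval O SEGMENT (k ∷ n ∷ c ∷ []) (codeVec (segment k n c))
SEGMENT-correct zero    n c = e-prim0 e-zer
SEGMENT-correct (suc k) n c = e-primS (SEGMENT-correct k n c)
  (eval-comp₁ e-succ (eval-comp₂ (PAIR-correct _ _)
    (eval-comp₂ (NTH-correct _ _) (eval-comp₂ (MONUS-correct _ _) e-proj (eval-comp₁ e-succ e-proj)) e-proj)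
    e-proj))

DIST : PR 2
DIST = comp ADD (MONUS ∷ comp MONUS (proj (# 1) ∷ proj (# 0) ∷ []) ∷ [])

DIST-correct : ∀ a b → Eval O DIST (a ∷ b ∷ []) (dist a b)
DIST-correct a b = eval-comp₂ (ADD-correct _ _) (MONUS-correct a b) (eval-comp₂ (MONUS-correct b a) e-proj e-proj)

IS-ZERO : ∀ {n} → PR n → PR n
IS-ZERO g = comp MONUS (CONST 1 ∷ g ∷ [])

IS-ZERO-correct : ∀ {n} {g : PR n} {xs t} → Eval O g xs t → Eval O (IS-ZERO g) xs (isZero t)
IS-ZERO-correct g = eval-comp₂ (MONUS-correct _ _) (CONST-correct 1 _) g

isZero≡0⇒≢0 : ∀ t → isZero t ≡ 0 → t ≢ 0
isZero≡0⇒≢0 zero    () refl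
isZero≡0⇒≢0 (suc t) _  ()

≢0⇒isZero≡0 : ∀ t → t ≢ 0 → isZero t ≡ 0
≢0⇒isZero≡0 zero    t≢0 = ⊥-elim (t≢0 refl)
≢0⇒isZero≡0 (suc t) _   = 0∸n≡0 t

isZero-χ : ∀ b → isZero (χ b) ≡ 0 → b ≡ true
isZero-χ true  _ = refl
isZero-χ false ()

dist≡0⇒≡ : ∀ a b → dist a b ≡ 0 → a ≡ b
dist≡0⇒≡ a b d≡0 = ≤-antisym (m∸n≡0⇒m≤n (m+n≡0⇒m≡0 (a ∸ b) d≡0)) (m∸n≡0⇒m≤n (m+n≡0⇒n≡0 (a ∸ b) d≡0))

dist-self : ∀ a → dist a a ≡ 0
dist-self a rewrite n∸n≡0 a = refl

tri-mono : ∀ {a b} → a ≤ b → tri a ≤ tri b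
tri-mono z≤n     = z≤n
tri-mono (s≤s p) = +-mono-≤ (s≤s p) (tri-mono p)

triRoot-spec : ∀ c → (tri (triRoot c) ≤ c) × (c < tri (suc (triRoot c)))
triRoot-spec zero = z≤n , s≤s z≤n
triRoot-spec (suc c) with triRoot-spec c | tri (suc (triRoot c)) ≤? suc c
... | lower , upper | yes reached = subst (λ s → (tri s ≤ suc c) × (suc c < tri (suc s))) (sym step) (reached , bound)
  where
  step : triRoot (suc c) ≡ suc (triRoot c)
  step = trans (cong (λ t → triRoot c + (1 ∸ t)) (m≤n⇒m∸n≡0 reached)) (+-comm (triRoot c) 1)
  bound : suc c < tri (suc (suc (triRoot c)))
  bound = s≤s (≤-trans upper (≤-trans (m≤n+m _ (triRoot c)) (n≤1+n _)))
... | lower , upper | no unreached = subst (λ s → (tri s ≤ suc c) × (suc c < tri (suc s))) (sym stay)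
                                           (≤-trans lower (n≤1+n c) , ≰⇒> unreached)
  where
  stay : triRoot (suc c) ≡ triRoot c
  stay = trans (cong (triRoot c +_) (≢0⇒isZero≡0 _ (>⇒≢ (m<n⇒0<n∸m (≰⇒> unreached)))))
               (+-identityʳ (triRoot c))

triRoot-unique : ∀ s c → tri s ≤ c → c < tri (suc s) → triRoot c ≡ s
triRoot-unique s c lower upper with triRoot-spec c | <-cmp (triRoot c) s
... | _ , upper′ | tri< r<s _ _ = ⊥-elim (<-irrefl refl (<-≤-trans upper′ (≤-trans (tri-mono r<s) lower)))
... | _ | tri≈ _ r≡s _ = r≡s
... | lower′ , _ | tri> _ _ s<r = ⊥-elim (<-irrefl refl (<-≤-trans upper (≤-trans (tri-mono s<r) lower′)))

triRoot-pair : ∀ x y → triRoot (pair x y) ≡ x + y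
triRoot-pair x y = triRoot-unique (x + y) (pair x y) (m≤m+n _ y) upper
  where
  upper : tri (x + y) + y < suc (x + y) + tri (x + y)
  upper = subst (_< suc (x + y) + tri (x + y)) (+-comm y (tri (x + y)))
                (s≤s (+-monoˡ-≤ (tri (x + y)) (m≤n+m y x)))

unpair₂-pair : ∀ x y → unpair₂ (pair x y) ≡ y
unpair₂-pair x y rewrite triRoot-pair x y = m+n∸m≡n (tri (x + y)) y

unpair₁-pair : ∀ x y → unpair₁ (pair x y) ≡ x
unpair₁-pair x y rewrite unpair₂-pair x y | triRoot-pair x y = m+n∸n≡m x y

-- The coding of vectors is injective, so a predictor's argument is
-- determined by its code.
codeVec-injective : ∀ {k} (u w : Vec ℕ k) → codeVec u ≡ codeVec w → u ≡ w
codeVec-injective []      []      _  = refl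
codeVec-injective (x ∷ u) (y ∷ w) eq = cong₂ _∷_
  (trans (sym (unpair₁-pair x (codeVec u))) (trans (cong unpair₁ eq′) (unpair₁-pair y (codeVec w))))
  (codeVec-injective u w
    (trans (sym (unpair₂-pair x (codeVec u))) (trans (cong unpair₂ eq′) (unpair₂-pair y (codeVec w)))))
  where
  eq′ = suc-injective eq

tail-drop : ∀ k (l : List ℕ) → tail (codeList (drop k l)) ≡ codeList (drop (suc k) l)
tail-drop zero    []      = refl
tail-drop (suc k) []      = refl
tail-drop zero    (x ∷ l) = unpair₂-pair x (codeList l)
tail-drop (suc k) (x ∷ l) = tail-drop k l

tails-drop : ∀ k (l : List ℕ) → tails k (codeList l) ≡ codeList (drop k l)
tails-drop zero    l = refl
tails-drop (suc k) l = trans (cong tail (tails-drop k l)) (tail-drop k l)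

drop-length-++ : ∀ (a l : List ℕ) → drop (length a) (a ++ l) ≡ l
drop-length-++ []      l = refl
drop-length-++ (x ∷ a) l = drop-length-++ a l

tails-at : ∀ (a l : List ℕ) → tails (length a) (codeList (a ++ l)) ≡ codeList l
tails-at a l = trans (tails-drop (length a) (a ++ l)) (cong codeList (drop-length-++ a l))

tails-past-end : ∀ n (l : List ℕ) → length l ≤ n → tails n (codeList l) ≡ 0
tails-past-end n l |l|≤n = trans (tails-drop n l) (cong codeList (drop-all n l |l|≤n))

nth-at : ∀ a x l → nth (length a) (codeList (a ++ x ∷ l)) ≡ x
nth-at a x l = begin
  head (tails (length a) (codeList (a ++ x ∷ l))) ≡⟨ cong head (tails-at a (x ∷ l)) ⟩
  head (codeList (x ∷ l))                         ≡⟨ unpair₁-pair x (codeList l) ⟩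
  x                                               ∎
  where open ≡-Reasoning

segment-correct : ∀ k n (a b rest : List ℕ) → length b ≡ k → n ≡ length a + k →
                  codeVec (segment k n (codeList (a ++ b ++ rest))) ≡ codeList b
segment-correct zero    n a []      rest refl _ = refl
segment-correct (suc k) n a (x ∷ b) rest |b|≡k n≡ = cong suc (cong₂ pair first others)
  where
  start : n ∸ suc k ≡ length a
  start = trans (cong (_∸ suc k) n≡) (m+n∸n≡m (length a) (suc k))
  first : nth (n ∸ suc k) (codeList (a ++ x ∷ b ++ rest)) ≡ x
  first = trans (cong (λ j → nth j (codeList (a ++ x ∷ b ++ rest))) start) (nth-at a x (b ++ rest))
  n≡′ : n ≡ length (a ++ x ∷ []) + k
  n≡′ = trans n≡ (trans (+-suc (length a) k) (cong (_+ k) (sym (trans (length-++ a) (+-comm (length a) 1)))))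
  others : codeVec (segment k n (codeList (a ++ x ∷ b ++ rest))) ≡ codeList b
  others = subst (λ l → codeVec (segment k n (codeList l)) ≡ codeList b) (++-assoc a (x ∷ []) (b ++ rest))
                 (segment-correct k n (a ++ x ∷ []) b rest (suc-injective |b|≡k) n≡′)

segment-initial : ∀ n (b rest : List ℕ) → length b ≡ n →
                  codeVec (segment n n (codeList (b ++ rest))) ≡ codeList b
segment-initial n b rest |b|≡n = segment-correct n n [] b rest |b|≡n refl

prefix : (ℕ → ℕ) → ℕ → List ℕ
prefix f zero    = []
prefix f (suc n) = f 0 ∷ prefix (f ∘ suc) n

length-prefix : ∀ f n → length (prefix f n) ≡ n
length-prefix f zero    = refl
length-prefix f (suc n) = cong suc (length-prefix (f ∘ suc) n)

prefix-snoc : ∀ f n → prefix f (suc n) ≡ prefix f n ++ f n ∷ []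
prefix-snoc f zero    = refl
prefix-snoc f (suc n) = cong (f 0 ∷_) (prefix-snoc (f ∘ suc) n)

prefix-+ : ∀ f a b → prefix f (a + b) ≡ prefix f a ++ prefix (λ i → f (a + i)) b
prefix-+ f zero    b = refl
prefix-+ f (suc a) b = cong (f 0 ∷_) (prefix-+ (f ∘ suc) a b)

prefix-extends : ∀ f v N → v < N → Σ (List ℕ) λ rest → prefix f N ≡ prefix f v ++ f v ∷ rest
prefix-extends f v N v<N = rest , (begin
  prefix f N                                      ≡⟨ cong (prefix f) (sym v+[1+j]≡N) ⟩
  prefix f (v + suc j)                            ≡⟨ prefix-+ f v (suc j) ⟩
  prefix f v ++ f (v + 0) ∷ rest
                                                  ≡⟨ cong (λ x → prefix f v ++ x ∷ rest) (cong f (+-identityʳ v)) ⟩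
  prefix f v ++ f v ∷ rest                        ∎)
  where
  open ≡-Reasoning
  j = N ∸ suc v
  rest = prefix (λ i → f (v + suc i)) j
  v+[1+j]≡N : v + suc j ≡ N
  v+[1+j]≡N = trans (+-suc v j) (m+[n∸m]≡n v<N)

codeVec-restrict : ∀ f n → codeVec (restrict f n) ≡ codeList (prefix f n)
codeVec-restrict f zero    = refl
codeVec-restrict f (suc n) = cong (λ t → suc (pair (f 0) t)) (codeVec-restrict (f ∘ suc) n)

map-χ-restrictBin : ∀ G N → map χ (restrictBin G N) ≡ prefix (χ ∘ G) N
map-χ-restrictBin G zero    = refl
map-χ-restrictBin G (suc N) = begin
  map χ (restrictBin G N ++ G N ∷ [])       ≡⟨ map-++ χ (restrictBin G N) (G N ∷ []) ⟩
  map χ (restrictBin G N) ++ χ (G N) ∷ []   ≡⟨ cong (_++ χ (G N) ∷ []) (map-χ-restrictBin G N) ⟩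
  prefix (χ ∘ G) N ++ χ (G N) ∷ []          ≡⟨ sym (prefix-snoc (χ ∘ G) N) ⟩
  prefix (χ ∘ G) (suc N)                    ∎
  where open ≡-Reasoning

bit-avoiding : ∀ p → Σ Bool λ b → p ≢ χ b
bit-avoiding zero    = true , λ ()
bit-avoiding (suc p) = false , λ ()

-- A natural c
-- coding a list l "mispredicts at n" if n < |l|, m ≤ n, n ∈ D and
-- π_n(l↾n) ≠ l(n).  This is decided by a primitive recursive test, and
-- searching for a zero of the test enumerates the mispredicting strings.
module Misprediction (P : Predictor) (computable : ComputablePredictor P) (m : ℕ) where

  MispredictsAt : ℕ → ℕ → Set
  MispredictsAt n c = (tails n c ≢ 0) × (m ≤ n) × (D P n ≡ true) × (π P n (segment n n c) ≢ nth n c)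

  -- a sum of four 0/1 indicators, one for each failed condition
  errorTest : ℕ → ℕ → ℕ
  errorTest n c = isZero (tails n c) + ((m ∸ n) + (isZero (χ (D P n)) +
                  isZero (dist (π P n (segment n n c)) (nth n c))))

  errorTest-complete : ∀ n c → MispredictsAt n c → errorTest n c ≡ 0
  errorTest-complete n c (long , m≤n , n∈D , wrong)
    rewrite ≢0⇒isZero≡0 (tails n c) long | m≤n⇒m∸n≡0 m≤n | n∈D
          | ≢0⇒isZero≡0 (dist (π P n (segment n n c)) (nth n c)) (wrong ∘ dist≡0⇒≡ _ _) = refl

  errorTest-sound : ∀ n c → errorTest n c ≡ 0 → MispredictsAt n c
  errorTest-sound n c e≡0 =
      isZero≡0⇒≢0 _ long
    , m∸n≡0⇒m≤n m∸n≡0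
    , isZero-χ _ inD
    , λ right → isZero≡0⇒≢0 _ wrong (trans (cong (λ t → dist t (nth n c)) right) (dist-self (nth n c)))
    where
    long  = m+n≡0⇒m≡0 _ e≡0
    rest₁ = m+n≡0⇒n≡0 (isZero (tails n c)) e≡0
    m∸n≡0 = m+n≡0⇒m≡0 _ rest₁
    rest₂ = m+n≡0⇒n≡0 (m ∸ n) rest₁
    inD   = m+n≡0⇒m≡0 _ rest₂
    wrong = m+n≡0⇒n≡0 (isZero (χ (D P n))) rest₂

  ERROR-TEST : PR 2
  ERROR-TEST = comp ADD (IS-ZERO TAILS ∷
    comp ADD (comp MONUS (CONST m ∷ proj (# 0) ∷ []) ∷
      comp ADD (IS-ZERO (comp (proj₁ (proj₁ computable)) (proj (# 0) ∷ [])) ∷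
        IS-ZERO (comp DIST (comp (proj₁ (proj₂ computable))
                                 (proj (# 0) ∷ comp SEGMENT (proj (# 0) ∷ proj (# 0) ∷ proj (# 1) ∷ []) ∷ []) ∷
                            NTH ∷ [])) ∷ []) ∷ []) ∷ [])

  ERROR-TEST-correct : ∀ n c → Eval noOracle ERROR-TEST (n ∷ c ∷ []) (errorTest n c)
  ERROR-TEST-correct n c =
    eval-comp₂ (ADD-correct _ _) (IS-ZERO-correct (TAILS-correct n c))
      (eval-comp₂ (ADD-correct _ _) (eval-comp₂ (MONUS-correct _ _) (CONST-correct m _) e-proj)
        (eval-comp₂ (ADD-correct _ _) (IS-ZERO-correct (eval-comp₁ (proj₂ (proj₁ computable) n) e-proj))
          (IS-ZERO-correct (eval-comp₂ (DIST-correct _ _)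
            (eval-comp₂ (proj₂ (proj₂ computable) n (segment n n c)) e-proj
                        (eval-comp₃ (SEGMENT-correct n n c) e-proj e-proj e-proj))
            (NTH-correct n c)))))

  SEARCH : PR 1
  SEARCH = mu ERROR-TEST

  W-mispredicts : ∀ σ → W SEARCH σ → Σ ℕ λ n → MispredictsAt n (codeBin σ)
  W-mispredicts σ (n , e-mu halts _) =
    n , errorTest-sound n _ (eval-deterministic (ERROR-TEST-correct n (codeBin σ)) halts)

  mispredicting-extension : ∀ n (σ : List Bool) → length σ ≡ n → m ≤ n → D P n ≡ true →
                            Σ Bool λ b → W SEARCH (σ ++ b ∷ [])
  mispredicting-extension n σ |σ|≡n m≤n n∈D = b , subst (λ c → Σ ℕ λ v → Eval noOracle SEARCH (c ∷ []) v)
      (cong codeList (sym (map-++ χ σ (b ∷ []))))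
      (mu-halts ERROR-TEST (λ y → errorTest y (code (χ b))) (code (χ b) ∷ [])
                (λ y → ERROR-TEST-correct y (code (χ b))) n (errorTest-complete n _ mispredicts))
    where
    L = map χ σ
    |L|≡n : length L ≡ n
    |L|≡n = trans (length-map χ σ) |σ|≡n
    code : ℕ → ℕ
    code x = codeList (L ++ x ∷ [])
    -- the predictor sees the same history whatever bit comes next
    history : ∀ x → segment n n (code x) ≡ segment n n (code 0)
    history x = codeVec-injective _ _
      (trans (segment-initial n L (x ∷ []) |L|≡n) (sym (segment-initial n L (0 ∷ []) |L|≡n)))
    b = proj₁ (bit-avoiding (π P n (segment n n (code 0))))
    continues : tails n (code (χ b)) ≢ 0
    continues = subst (λ j → tails j (code (χ b)) ≢ 0) |L|≡n
                      (λ tails≡0 → 1+n≢0 (trans (sym (tails-at L (χ b ∷ []))) tails≡0))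
    value : nth n (code (χ b)) ≡ χ b
    value = subst (λ j → nth j (code (χ b)) ≡ χ b) |L|≡n (nth-at L (χ b) [])
    mispredicts : MispredictsAt n (code (χ b))
    mispredicts = continues , m≤n , n∈D , λ right → proj₂ (bit-avoiding _) (begin
      π P n (segment n n (code 0))     ≡⟨ cong (π P n) (sym (history (χ b))) ⟩
      π P n (segment n n (code (χ b))) ≡⟨ right ⟩
      nth n (code (χ b))               ≡⟨ value ⟩
      χ b                              ∎)
      where open ≡-Reasoning

  -- pad σ with zeros up to an element of D beyond m, then extend as above
  dense : Dense (W SEARCH)
  dense σ = σ′ ++ b ∷ [] , (replicate k false ++ b ∷ [] , ++-assoc σ (replicate k false) (b ∷ [])) , inW
    where
    beyond = infinite P (m ⊔ length σ)
    n = proj₁ beyond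
    m⊔|σ|≤n = proj₁ (proj₂ beyond)
    k = n ∸ length σ
    σ′ = σ ++ replicate k false
    |σ′|≡n : length σ′ ≡ n
    |σ′|≡n = trans (length-++ σ) (trans (cong (length σ +_) (length-replicate k))
               (m+[n∸m]≡n (≤-trans (m≤n⊔m m (length σ)) m⊔|σ|≤n)))
    extension = mispredicting-extension n σ′ |σ′|≡n (≤-trans (m≤m⊔n m (length σ)) m⊔|σ|≤n) (proj₂ (proj₂ beyond))
    b = proj₁ extension
    inW = proj₂ extension

  predicted⇒no-misprediction : ∀ f → (∀ n → m ≤ n → D P n ≡ true → π P n (restrict f n) ≡ f n) →
                               ∀ N v → ¬ MispredictsAt v (codeList (prefix f N))
  predicted⇒no-misprediction f correct N v (long , m≤v , v∈D , wrong) with v <? N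
  ... | no v≮N = long (tails-past-end v (prefix f N) (subst (_≤ v) (sym (length-prefix f N)) (≮⇒≥ v≮N)))
  ... | yes v<N with prefix-extends f v N v<N
  ...   | rest , split rewrite split = wrong (begin
    π P v (segment v v (codeList (prefix f v ++ f v ∷ rest))) ≡⟨ cong (π P v) history ⟩
    π P v (restrict f v)                                     ≡⟨ correct v m≤v v∈D ⟩
    f v                                                      ≡⟨ sym value ⟩
    nth v (codeList (prefix f v ++ f v ∷ rest))              ∎)
    where
    open ≡-Reasoning
    history : segment v v (codeList (prefix f v ++ f v ∷ rest)) ≡ restrict f v
    history = codeVec-injective _ _
      (trans (segment-initial v (prefix f v) (f v ∷ rest) (length-prefix f v)) (sym (codeVec-restrict f v)))
    value : nth v (codeList (prefix f v ++ f v ∷ rest)) ≡ f v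
    value = subst (λ j → nth j (codeList (prefix f v ++ f v ∷ rest)) ≡ f v) (length-prefix f v)
                  (nth-at (prefix f v) (f v) rest)

mainTheorem6 : (A : ℕ → Bool) →
    Σ (ℕ → Bool) (λ G → (G ≤TSet A) × Weakly1Generic G) →
    EvasionDegree A
mainTheorem6 A (G , G≤A , generic) = χ ∘ G , G≤A , evades
  where
  evades : ∀ (P : Predictor) → ComputablePredictor P → Evades (χ ∘ G) P
  evades P computable (m , correct) =
    let open Misprediction P computable m
        (N , inW)         = generic SEARCH dense
        (v , mispredicts) = W-mispredicts (restrictBin G N) inW
    in predicted⇒no-misprediction (χ ∘ G) correct N v
         (subst (MispredictsAt v ∘ codeList) (map-χ-restrictBin G N) mispredicts)
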